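{- Let $G$ be a connected graph with at least $2$ vertices. Then $\mu_{\rm t}(G)=0$ if and only if $\mathrm{bp}(G)=0$, i.e., if and only if every vertex of $G$ is the middle vertex of some convex $P_3$ in $G$.
   Context: All graphs are finite, simple and connected. For $X\subseteq V(G)$, two vertices $x,y$ are $X$-visible if there is a shortest $x,y$-path $P$ with $V(P)\cap X\subseteq\{x,y\}$; $X$ is a total mutual-visibility set if every pair of vertices of $G$ is $X$-visible. $\mu_{\rm t}(G)$ is the largest cardinality of a total mutual-visibility set of $G$. A subgraph $H$ of $G$ is convex if for all $x,y\in V(H)$ every shortest $x,y$-path of $G$ lies in $H$. A vertex is a bypass vertex if it is not the middle vertex of a convex $P_3$ in $G$; $\mathrm{bp}(G)$ is the number of bypass vertices. -}

module Defs where

open import Data.Nat using (ℕ; zero; suc; _≤_)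
open import Data.Fin using (Fin)
open import Data.Fin.Subset using (Subset; _∈_; _∉_; ∣_∣)
open import Data.Bool using (Bool; true; false)
open import Data.Product using (Σ; ∃; ∃-syntax; _×_; _,_)
open import Data.Sum using (_⊎_)
open import Relation.Nullary using (¬_)
open import Relation.Binary.PropositionalEquality using (_≡_; _≢_)

record Graph (n : ℕ) : Set where
  field
    adj     : Fin n → Fin n → Bool
    symm    : ∀ x y → adj x y ≡ adj y x
    irrefl  : ∀ x → adj x x ≡ false

open Graph public

module _ {n : ℕ} (G : Graph n) where

  data Walk : Fin n → Fin n → Set where
    []  : ∀ {x} → Walk x x
    _∷_ : ∀ {x y z} → adj G x y ≡ true → Walk y z → Walk x z

  length : ∀ {x y} → Walk x y → ℕ
  length []      = zero
  length (_ ∷ w) = suc (length w)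

  OnWalk : ∀ {x y} → Fin n → Walk x y → Set
  OnWalk v ([] {x})      = v ≡ x
  OnWalk v (_∷_ {x} _ w) = v ≡ x ⊎ OnWalk v w

  Internal : ∀ {x y} → Fin n → Walk x y → Set
  Internal v []                = Data.Empty.⊥
    where import Data.Empty
  Internal v (_ ∷ [])          = Data.Empty.⊥
    where import Data.Empty
  Internal v (_∷_ {_} {y} _ w@(_ ∷ _)) = v ≡ y ⊎ Internal v w

  OnWalkEdge : ∀ {x y} → Fin n → Fin n → Walk x y → Set
  OnWalkEdge p q []                    = Data.Empty.⊥
    where import Data.Empty
  OnWalkEdge p q (_∷_ {x} {y} _ w) =
    ((p ≡ x × q ≡ y) ⊎ (p ≡ y × q ≡ x)) ⊎ OnWalkEdge p q w

  -- shortest x,y-path (a shortest walk is necessarily a path)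
  IsShortest : ∀ {x y} → Walk x y → Set
  IsShortest {x} {y} w = ∀ (w' : Walk x y) → length w ≤ length w'

  Connected : Set
  Connected = ∀ x y → Walk x y

  Visible : Subset n → Fin n → Fin n → Set
  Visible X x y = Σ (Walk x y) λ w → IsShortest w × (∀ v → Internal v w → v ∉ X)

  IsTotalMutualVisibility : Subset n → Set
  IsTotalMutualVisibility X = ∀ x y → Visible X x y

  MuT≡ : ℕ → Set
  MuT≡ k = (Σ (Subset n) λ X → IsTotalMutualVisibility X × ∣ X ∣ ≡ k)
         × (∀ X → IsTotalMutualVisibility X → ∣ X ∣ ≤ k)

  -- The subgraph P with vertices a,v,b and edges av, vb is a P3 in G
  -- (a ≠ b, a ~ v, v ~ b) which is convex: for all x,y ∈ V(P), every
  -- shortest x,y-path of G lies in P (all its vertices and edges are in P).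
  InP3Vertex : Fin n → Fin n → Fin n → Fin n → Set
  InP3Vertex a v b u = u ≡ a ⊎ u ≡ v ⊎ u ≡ b

  InP3Edge : Fin n → Fin n → Fin n → Fin n → Fin n → Set
  InP3Edge a v b p q =
    (p ≡ a × q ≡ v) ⊎ (p ≡ v × q ≡ a) ⊎ (p ≡ v × q ≡ b) ⊎ (p ≡ b × q ≡ v)

  IsConvexP3 : Fin n → Fin n → Fin n → Set
  IsConvexP3 a v b =
    a ≢ b × adj G a v ≡ true × adj G v b ≡ true ×
    (∀ x y → InP3Vertex a v b x → InP3Vertex a v b y →
       (w : Walk x y) → IsShortest w →
         (∀ u → OnWalk u w → InP3Vertex a v b u) ×
         (∀ p q → OnWalkEdge p q w → InP3Edge a v b p q))

  IsMiddleOfConvexP3 : Fin n → Set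
  IsMiddleOfConvexP3 v = ∃[ a ] ∃[ b ] IsConvexP3 a v b

  IsBypass : Fin n → Set
  IsBypass v = ¬ IsMiddleOfConvexP3 v

  NoBypass : Set
  NoBypass = ∀ v → ¬ IsBypass v

-- If v is a bypass vertex, a shortest path through v as an inner vertex, entering from x and
-- leaving to y, has x and y at distance 2; as x v y is not convex, x and y have another common
-- neighbour, and replacing v by it keeps the path shortest. So {v} is a total mutual-visibility
-- set and μ_t(G) ≥ 1. Conversely, if v is the middle vertex of a convex P3 a v b, the only
-- shortest a,b-path is a v b, so no total mutual-visibility set contains v; if there are no
-- bypass vertices, the empty set is the only one.
module Submission where

open import Defs
open import Data.Nat using (ℕ; zero; suc; _≤_; z≤n; s≤s)
open import Data.Nat.Properties using (≤-pred; ≤-refl; ≤-reflexive; ≤-trans; ≰⇒>; n≤1+n; 1+n≰n; suc-injective; _≤?_)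
open import Data.Fin using (Fin; toℕ; fromℕ<)
open import Data.Fin.Properties using (any?; toℕ<n; toℕ-fromℕ<) renaming (_≟_ to _≟F_)
open import Data.Fin.Subset using (Subset; _∈_; _∉_; ∣_∣; ⁅_⁆) renaming (⊥ to ∅)
open import Data.Fin.Subset.Properties using (∣⊥∣≡0; ∣⁅x⁆∣≡1; x∈⁅y⁆⇒x≡y; ∉⊥; nonempty?; Empty-unique)
open import Data.Bool using (true)
open import Data.Bool.Properties using () renaming (_≟_ to _≟B_)
open import Data.Product using (Σ; ∃; _×_; _,_)
open import Data.Sum using (_⊎_; inj₁; inj₂)
open import Data.Empty using (⊥; ⊥-elim)
open import Relation.Nullary using (¬_; Dec; yes; no; contradiction)
open import Relation.Nullary.Decidable using (_×-dec_; ¬?; decidable-stable)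
open import Relation.Binary.PropositionalEquality using (_≡_; _≢_; refl; sym; trans; cong; subst)

module _ {n : ℕ} (G : Graph n) where

  private variable
    a b m v x y z : Fin n

  adj-irrefl : adj G x x ≢ true
  adj-irrefl {x} xx = contradiction (trans (sym xx) (irrefl G x)) λ ()

  adj-sym : adj G x y ≡ true → adj G y x ≡ true
  adj-sym {x} {y} xy = trans (symm G y x) xy

  CommonNeighbour : Fin n → Fin n → Fin n → Set
  CommonNeighbour x y c = adj G x c ≡ true × adj G c y ≡ true

  commonNeighbour? : ∀ x y c → Dec (CommonNeighbour x y c)
  commonNeighbour? x y c = (adj G x c ≟B true) ×-dec (adj G c y ≟B true)

  Distance≥2 : Fin n → Fin n → Set
  Distance≥2 x y = x ≢ y × adj G x y ≢ true

  Distance≥2-sym : Distance≥2 x y → Distance≥2 y x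
  Distance≥2-sym (x≢y , ¬xy) = (λ y≡x → x≢y (sym y≡x)) , (λ yx → ¬xy (adj-sym yx))

  IsShortest-tail : (e : adj G x y ≡ true) (w : Walk G y z) → IsShortest G (_∷_ {G = G} e w) → IsShortest G w
  IsShortest-tail e w shortest w′ = ≤-pred (shortest (e ∷ w′))

  shortest⇒Distance≥2 : (e : adj G x y ≡ true) (e′ : adj G y z ≡ true) (w : Walk G z b) →
                        IsShortest G (_∷_ {G = G} e (e′ ∷ w)) → Distance≥2 x z
  shortest⇒Distance≥2 {x} {z = z} e e′ w shortest = x≢z , ¬xz
    where
    x≢z : x ≢ z
    x≢z refl = 1+n≰n (≤-trans (n≤1+n _) (shortest w))
    ¬xz : adj G x z ≢ true
    ¬xz xz = 1+n≰n (≤-pred (shortest (xz ∷ w)))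

  walkOfLength? : ∀ k x y → Dec (Σ (Walk G x y) λ w → length G w ≡ k)
  walkOfLength? zero x y with x ≟F y
  ... | yes refl = yes ([] , refl)
  ... | no x≢y   = no λ { ([] , _) → x≢y refl ; ((_ ∷ _) , ()) }
  walkOfLength? (suc k) x y with any? (λ c → (adj G x c ≟B true) ×-dec walkOfLength? k c y)
  ... | yes (c , xc , w , refl) = yes ((xc ∷ w) , refl)
  ... | no none = no λ { ([] , ()) ; (_∷_ {y = c} xc w , len) → none (c , xc , w , suc-injective len) }

  -- The fuel bounds the length of w, and each recursive call strictly shortens the walk.
  shortestWalk-within : ∀ fuel (w : Walk G x y) → length G w ≤ fuel → Σ (Walk G x y) (IsShortest G)
  shortestWalk-within zero [] _ = [] , λ _ → z≤n
  shortestWalk-within {x} {y} (suc fuel) w len≤ with any? {n = length G w} (λ i → walkOfLength? (toℕ i) x y)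
  ... | yes (i , w′ , len≡i) =
    shortestWalk-within fuel w′ (subst (_≤ fuel) (sym len≡i) (≤-pred (≤-trans (toℕ<n i) len≤)))
  ... | no none = w , minimal
    where
    minimal : IsShortest G w
    minimal w′ with length G w ≤? length G w′
    ... | yes w≤w′ = w≤w′
    ... | no w≰w′  = ⊥-elim (none (fromℕ< (≰⇒> w≰w′) , w′ , sym (toℕ-fromℕ< (≰⇒> w≰w′))))

  shortestWalk : Walk G x y → Σ (Walk G x y) (IsShortest G)
  shortestWalk w = shortestWalk-within _ w ≤-refl

  module P3 (a m b : Fin n) where

    private
      P = InP3Vertex G a m b
      E = InP3Edge G a m b

    LiesIn : Walk G x y → Set
    LiesIn w = (∀ u → OnWalk G u w → P u) × (∀ p q → OnWalkEdge G p q w → E p q)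

    E-sym : ∀ {p q} → E p q → E q p
    E-sym (inj₁ (refl , refl))               = inj₂ (inj₁ (refl , refl))
    E-sym (inj₂ (inj₁ (refl , refl)))        = inj₁ (refl , refl)
    E-sym (inj₂ (inj₂ (inj₁ (refl , refl)))) = inj₂ (inj₂ (inj₂ (refl , refl)))
    E-sym (inj₂ (inj₂ (inj₂ (refl , refl)))) = inj₂ (inj₂ (inj₁ (refl , refl)))

    E-hasMiddle : ∀ {p q} → E p q → p ≡ m ⊎ q ≡ m
    E-hasMiddle (inj₁ (_ , q≡m))               = inj₂ q≡m
    E-hasMiddle (inj₂ (inj₁ (p≡m , _)))        = inj₁ p≡m
    E-hasMiddle (inj₂ (inj₂ (inj₁ (p≡m , _)))) = inj₁ p≡m
    E-hasMiddle (inj₂ (inj₂ (inj₂ (_ , q≡m)))) = inj₂ q≡m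

    []-liesIn : ∀ x → P x → LiesIn ([] {G = G} {x})
    []-liesIn _ x∈P = (λ { _ refl → x∈P }) , λ _ _ ()

    ∷-liesIn : (e : adj G x y ≡ true) (w : Walk G y z) → P x → E x y → LiesIn w → LiesIn (e ∷ w)
    ∷-liesIn _ _ x∈P xy∈E (vertices , edges) =
      (λ { _ (inj₁ refl) → x∈P ; u (inj₂ u∈w) → vertices u u∈w }) ,
      (λ { _ _ (inj₁ (inj₁ (refl , refl))) → xy∈E
         ; _ _ (inj₁ (inj₂ (refl , refl))) → E-sym xy∈E
         ; p q (inj₂ pq∈w)                 → edges p q pq∈w })

    shortest-loop-liesIn : P x → (w : Walk G x x) → IsShortest G w → LiesIn w
    shortest-loop-liesIn x∈P [] _ = []-liesIn _ x∈P
    shortest-loop-liesIn x∈P (_ ∷ _) shortest with shortest []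
    ... | ()

    shortest-edge-liesIn : P x → P y → E x y → adj G x y ≡ true → (w : Walk G x y) → IsShortest G w → LiesIn w
    shortest-edge-liesIn _ _ _ xy [] _ = ⊥-elim (adj-irrefl xy)
    shortest-edge-liesIn x∈P y∈P xy∈E _ (e ∷ []) _ = ∷-liesIn e [] x∈P xy∈E ([]-liesIn _ y∈P)
    shortest-edge-liesIn _ _ _ xy (_ ∷ (_ ∷ _)) shortest with shortest (xy ∷ [])
    ... | s≤s ()

    shortest-via-liesIn : Distance≥2 x y → CommonNeighbour x y m → (∀ c → CommonNeighbour x y c → c ≡ m) →
                          P x → P y → E x m → E m y → (w : Walk G x y) → IsShortest G w → LiesIn w
    shortest-via-liesIn (x≢y , _) _ _ _ _ _ _ [] _ = ⊥-elim (x≢y refl)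
    shortest-via-liesIn (_ , ¬xy) _ _ _ _ _ _ (xy ∷ []) _ = ⊥-elim (¬xy xy)
    shortest-via-liesIn _ _ unique x∈P y∈P xm∈E my∈E (_∷_ {y = c} xc (cy ∷ [])) _
      with refl ← unique c (xc , cy) =
      ∷-liesIn xc (cy ∷ []) x∈P xm∈E (∷-liesIn cy [] (inj₂ (inj₁ refl)) my∈E ([]-liesIn _ y∈P))
    shortest-via-liesIn _ (xm , my) _ _ _ _ _ (_ ∷ (_ ∷ (_ ∷ _))) shortest with shortest (xm ∷ (my ∷ []))
    ... | s≤s (s≤s ())

  uniqueCommonNeighbour⇒IsConvexP3 : Distance≥2 a b → CommonNeighbour a b m →
                                     (∀ c → CommonNeighbour a b c → c ≡ m) → IsConvexP3 G a m b
  uniqueCommonNeighbour⇒IsConvexP3 {a} {b} {m} far@(a≢b , _) common@(am , mb) unique =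
    a≢b , am , mb , convex
    where
    open P3 a m b
    unique′ : ∀ c → CommonNeighbour b a c → c ≡ m
    unique′ c (bc , ca) = unique c (adj-sym ca , adj-sym bc)

    a∈P : InP3Vertex G a m b a
    a∈P = inj₁ refl
    m∈P : InP3Vertex G a m b m
    m∈P = inj₂ (inj₁ refl)
    b∈P : InP3Vertex G a m b b
    b∈P = inj₂ (inj₂ refl)
    am∈E : InP3Edge G a m b a m
    am∈E = inj₁ (refl , refl)
    ma∈E : InP3Edge G a m b m a
    ma∈E = inj₂ (inj₁ (refl , refl))
    mb∈E : InP3Edge G a m b m b
    mb∈E = inj₂ (inj₂ (inj₁ (refl , refl)))
    bm∈E : InP3Edge G a m b b m
    bm∈E = inj₂ (inj₂ (inj₂ (refl , refl)))

    convex : ∀ x y → InP3Vertex G a m b x → InP3Vertex G a m b y →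
             (w : Walk G x y) → IsShortest G w → LiesIn w
    convex _ _ (inj₁ refl)        (inj₁ refl)        = shortest-loop-liesIn a∈P
    convex _ _ (inj₁ refl)        (inj₂ (inj₁ refl)) = shortest-edge-liesIn a∈P m∈P am∈E am
    convex _ _ (inj₁ refl)        (inj₂ (inj₂ refl)) = shortest-via-liesIn far common unique a∈P b∈P am∈E mb∈E
    convex _ _ (inj₂ (inj₁ refl)) (inj₁ refl)        = shortest-edge-liesIn m∈P a∈P ma∈E (adj-sym am)
    convex _ _ (inj₂ (inj₁ refl)) (inj₂ (inj₁ refl)) = shortest-loop-liesIn m∈P
    convex _ _ (inj₂ (inj₁ refl)) (inj₂ (inj₂ refl)) = shortest-edge-liesIn m∈P b∈P mb∈E mb
    convex _ _ (inj₂ (inj₂ refl)) (inj₁ refl)        =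
      shortest-via-liesIn (Distance≥2-sym far) (adj-sym mb , adj-sym am) unique′ b∈P a∈P bm∈E ma∈E
    convex _ _ (inj₂ (inj₂ refl)) (inj₂ (inj₁ refl)) = shortest-edge-liesIn b∈P m∈P bm∈E (adj-sym mb)
    convex _ _ (inj₂ (inj₂ refl)) (inj₂ (inj₂ refl)) = shortest-loop-liesIn b∈P

  IsConvexP3⇒nonadjacent-ends : IsConvexP3 G a m b → adj G a b ≢ true
  IsConvexP3⇒nonadjacent-ends {a} {m} {b} (a≢b , am , mb , convex) ab
    with convex a b (inj₁ refl) (inj₂ (inj₂ refl)) (ab ∷ []) shortest
    where
    shortest : IsShortest G (_∷_ {G = G} ab [])
    shortest []      = ⊥-elim (a≢b refl)
    shortest (_ ∷ _) = s≤s z≤n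
  ... | _ , edges with P3.E-hasMiddle a m b (edges a b (inj₁ (inj₁ (refl , refl))))
  ... | inj₁ refl = adj-irrefl am
  ... | inj₂ refl = adj-irrefl mb

  IsConvexP3⇒¬Visible : ∀ {X : Subset n} → IsConvexP3 G a m b → m ∈ X → ¬ Visible G X a b
  IsConvexP3⇒¬Visible {a} {m} {b} {X} convexP3@(a≢b , _ , _ , convex) m∈X (w , shortest , avoids) =
    blocked w shortest avoids (convex a b (inj₁ refl) (inj₂ (inj₂ refl)) w shortest)
    where
    blocked : (w : Walk G a b) → IsShortest G w → (∀ u → Internal G u w → u ∉ X) → P3.LiesIn a m b w → ⊥
    blocked [] _ _ _ = a≢b refl
    blocked (ab ∷ []) _ _ _ = IsConvexP3⇒nonadjacent-ends convexP3 ab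
    blocked (_∷_ {y = c} ac (_ ∷ _)) shortest avoids (vertices , _) with vertices c (inj₂ (inj₁ refl))
    ... | inj₁ refl        = adj-irrefl ac
    ... | inj₂ (inj₁ refl) = avoids c (inj₁ refl) m∈X
    ... | inj₂ (inj₂ refl) with shortest (ac ∷ [])
    ...   | s≤s ()

  ∅-isTotalMutualVisibility : Connected G → IsTotalMutualVisibility G ∅
  ∅-isTotalMutualVisibility connected x y =
    let w , shortest = shortestWalk (connected x y) in w , shortest , λ _ _ → ∉⊥

  NoBypass⇒totalMutualVisibility-empty : NoBypass G → ∀ {X} → IsTotalMutualVisibility G X → ∣ X ∣ ≤ 0
  NoBypass⇒totalMutualVisibility-empty noBypass {X} visibility with nonempty? X
  ... | yes (v , v∈X) = ⊥-elim (noBypass v λ (a , b , convexP3) → IsConvexP3⇒¬Visible convexP3 v∈X (visibility a b))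
  ... | no empty      = ≤-reflexive (trans (cong ∣_∣ (Empty-unique empty)) (∣⊥∣≡0 n))

  Avoids : Fin n → Walk G x y → Set
  Avoids v w = ∀ u → Internal G u w → u ≢ v

  ∷-avoids : (e : adj G x y ≡ true) (w : Walk G y z) → y ≢ v → Avoids v w → Avoids v (e ∷ w)
  ∷-avoids e []      _   _      _ ()
  ∷-avoids e (_ ∷ _) y≢v _      _ (inj₁ refl) = y≢v
  ∷-avoids e (_ ∷ _) _   avoids u (inj₂ u∈w)  = avoids u u∈w

  module _ {v : Fin n} (bypass : IsBypass G v) where

    detour : (e : adj G x v ≡ true) (e′ : adj G v y ≡ true) (w : Walk G y z) →
             IsShortest G (_∷_ {G = G} e (e′ ∷ w)) → ∃ λ c → c ≢ v × CommonNeighbour x y c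
    detour {x} {y} e e′ w shortest with any? (λ c → ¬? (c ≟F v) ×-dec commonNeighbour? x y c)
    ... | yes found = found
    ... | no none   = ⊥-elim (bypass (x , y , uniqueCommonNeighbour⇒IsConvexP3
                                                  (shortest⇒Distance≥2 e e′ w shortest) (e , e′) unique))
      where
      unique : ∀ c → CommonNeighbour x y c → c ≡ v
      unique c common = decidable-stable (c ≟F v) λ c≢v → none (c , c≢v , common)

    reroute : (e : adj G x y ≡ true) (w : Walk G y z) → IsShortest G (_∷_ {G = G} e w) →
              Σ (Walk G x z) λ w′ → length G w′ ≡ suc (length G w) × Avoids v w′
    reroute e [] _ = (e ∷ []) , refl , λ _ ()
    reroute {y = y} e (e′ ∷ w) shortest with y ≟F v
    ... | no y≢v =
      let w′ , len≡ , avoids = reroute e′ w (IsShortest-tail e (e′ ∷ w) shortest)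
      in (e ∷ w′) , cong suc len≡ , ∷-avoids e w′ y≢v avoids
    ... | yes refl =
      let c , c≢v , xc , cy = detour e e′ w shortest
          w′ , len≡ , avoids = reroute cy w (IsShortest-tail xc (cy ∷ w) shortest)
      in (xc ∷ w′) , cong suc len≡ , ∷-avoids xc w′ c≢v avoids

    bypass⇒singleton-isTotalMutualVisibility : Connected G → IsTotalMutualVisibility G ⁅ v ⁆
    bypass⇒singleton-isTotalMutualVisibility connected x y with shortestWalk (connected x y)
    ... | [] , _ = [] , (λ _ → z≤n) , λ _ ()
    ... | e ∷ w , shortest =
      let w′ , len≡ , avoids = reroute e w shortest
      in w′ , (λ w″ → subst (_≤ length G w″) (sym len≡) (shortest w″))
            , λ u u∈w′ u∈⁅v⁆ → avoids u u∈w′ (x∈⁅y⁆⇒x≡y v u∈⁅v⁆)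

-- The hypothesis 2 ≤ n is unused: the equivalence also holds for n < 2.
theorem3p3 : ∀ {n} (G : Graph n) → 2 ≤ n → Connected G →
    (MuT≡ G 0 → NoBypass G) × (NoBypass G → MuT≡ G 0)
theorem3p3 {n} G _ connected = μt≡0⇒noBypass , noBypass⇒μt≡0
  where
  μt≡0⇒noBypass : MuT≡ G 0 → NoBypass G
  μt≡0⇒noBypass (_ , maximal) v bypass =
    contradiction (subst (_≤ 0) (∣⁅x⁆∣≡1 v) (maximal ⁅ v ⁆ singleton-visibility)) λ ()
    where
    singleton-visibility : IsTotalMutualVisibility G ⁅ v ⁆
    singleton-visibility = bypass⇒singleton-isTotalMutualVisibility G bypass connected

  noBypass⇒μt≡0 : NoBypass G → MuT≡ G 0
  noBypass⇒μt≡0 noBypass =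
    (∅ , ∅-isTotalMutualVisibility G connected , ∣⊥∣≡0 n) ,
    λ _ → NoBypass⇒totalMutualVisibility-empty G noBypass
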